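{- Let $\mathcal T$ be a deplete tableau of order $t+1$. Then $\operatorname{Supp}(f_{\mathcal T}-h)=\operatorname{Supp}\mathcal T$.
   Context: Let $T=\{1,\dots,t\}$, $\hat T=\{1,\dots,t+1\}$. A diagram of order $t+1$ is a tuple $(h_1,\dots,h_{t+1})$ of non-negative integers, pictured as columns $C_1,\dots,C_{t+1}$ of unit blocks; $B(i,j)$ is the block of $C_i$ at level $j\le h_i$, $R_j$ the set of blocks at level $j$. Two distinct columns of height $\ge s$ are neighbours at level $s$ if all columns strictly between have height $<s$. A column is left (resp. right) extremal if it has no neighbour to its left (resp. right) at level equal to its height. Boundary conditions (always imposed): left extremal columns have even or maximal height; right extremal columns have odd or maximal height. Adjoining a domino: adding two blocks on top of a column of height $i$; even/odd as $i$ is; left (resp. right) if the enlarged column is the left (resp. right) neighbour at levels $i+1,i+2$ of some column of height $\ge i+2$. A diagram is deplete if no left even or right odd domino can be removed from it (it is not obtained from another diagram by adjoining such a domino). Tableau: at each non-empty level $j$ the extremal block of $R_j$ is its rightmost block ($j$ odd) or leftmost ($j$ even), with no entry; $b(i,1)=i$ for non-extremal $B(i,1)$; for $j\ge1$ and non-extremal $B(i,j+1)$, $b(i,j+1)=b(k,j)$ with $C_k$ the left ($j$ odd) resp. right ($j$ even) neighbour of $C_i$ at level $j$. Functions: indeterminates $c_i$ ($i\in T$), $m^i$ ($i\in\hat T$); for $i<j$, $r^i-r^j:=m^i+2m^{i+1}+\dots+2m^{j-1}+m^j$, $r^j-r^i:=-(r^i-r^j)$; $h=-\sum_{i\in T}c_im^i$;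 for level $s$ with columns of height $\ge s$ indexed $u_1<\dots<u_k$: $f_{R_s}=\sum_{i=1}^{k-1}c_{b(u_i,s)}(r^{u_i}-r^{u_{i+1}})$ ($s$ odd), $\sum_{i=2}^kc_{b(u_i,s)}(r^{u_i}-r^{u_{i-1}})$ ($s$ even); $f_{\mathcal T}=h+\sum_{s\ge1}f_{R_s}$. For a polynomial $f$, $\operatorname{Supp}f$ is the set of $i\in T$ such that $f$ depends non-trivially on $c_i$; $\operatorname{Supp}\mathcal T$ is the set of $i\in T$ such that the column $C_i$ is non-empty. -}

module Defs where

open import Data.Nat as ℕ using (ℕ; zero; suc; _≤_; _<_; _%_; _⊔_; _+_; _≡ᵇ_; _<ᵇ_)
open import Data.Fin as Fin using (Fin; toℕ; inject₁)
import Data.Fin.Properties as FinP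
open import Data.Integer as ℤ using (ℤ; +_; -_)
open import Data.Bool using (Bool; true; false; if_then_else_; _∨_; _∧_)
open import Data.Product using (_×_; ∃; _,_)
open import Data.Sum using (_⊎_)
open import Relation.Nullary using (¬_; Dec; does)
open import Relation.Nullary.Decidable using (_×-dec_; _→-dec_)
open import Relation.Binary.PropositionalEquality using (_≡_; _≢_)

-- Diagrams of order t+1.  Columns C_1..C_{t+1} are indexed by
-- Fin (suc t) (column C_{k+1} is the element with toℕ = k).
-- A diagram is given by its column heights.

Diagram : ℕ → Set
Diagram t = Fin (suc t) → ℕ

Even Odd : ℕ → Set
Even n = n % 2 ≡ 0
Odd  n = n % 2 ≡ 1

maxH : ∀ {n} → (Fin n → ℕ) → ℕ
maxH {zero}  H = 0
maxH {suc n} H = H Fin.zero ⊔ maxH (λ k → H (Fin.suc k))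

module _ {t : ℕ} (H : Diagram t) where

  -- Nb s a b : columns a < b are neighbours at level s
  -- (a is the left neighbour of b, b the right neighbour of a).
  Nb : ℕ → Fin (suc t) → Fin (suc t) → Set
  Nb s a b = (a Fin.< b) × (s ≤ H a) × (s ≤ H b)
           × (∀ k → a Fin.< k → k Fin.< b → H k < s)

  Nb? : ∀ s a b → Dec (Nb s a b)
  Nb? s a b = (a FinP.<? b) ×-dec (s ℕ.≤? H a) ×-dec (s ℕ.≤? H b)
            ×-dec FinP.all? (λ k → (a FinP.<? k) →-dec ((k FinP.<? b) →-dec (suc (H k) ℕ.≤? s)))

  LeftExtremal RightExtremal : Fin (suc t) → Set
  LeftExtremal  i = ¬ (∃ λ a → Nb (H i) a i)
  RightExtremal i = ¬ (∃ λ b → Nb (H i) i b)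

  BoundaryConditions : Set
  BoundaryConditions = ∀ i →
      (LeftExtremal  i → Even (H i) ⊎ H i ≡ maxH H)
    × (RightExtremal i → Odd  (H i) ⊎ H i ≡ maxH H)

  -- The domino adjoined to column i (which had height x before) is left / right
  LeftDomino RightDomino : Fin (suc t) → ℕ → Set
  LeftDomino  i x = ∃ λ k → Nb (suc x) i k × Nb (suc (suc x)) i k
  RightDomino i x = ∃ λ k → Nb (suc x) k i × Nb (suc (suc x)) k i

  ExtremalBlock : Fin (suc t) → ℕ → Set
  ExtremalBlock i j = (Odd j × (∀ k → i Fin.< k → H k < j))
                    ⊎ (Even j × (∀ k → k Fin.< i → H k < j))

IsDiagram : ∀ {t} → Diagram t → Set
IsDiagram H = BoundaryConditions H

AdjoinDomino : ∀ {t} → Diagram t → Fin (suc t) → Diagram t → Set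
AdjoinDomino H' i H = (H i ≡ H' i + 2) × (∀ k → k ≢ i → H k ≡ H' k)

HasRemovableDomino : ∀ {t} → Diagram t → Set
HasRemovableDomino {t} H = ∃ λ (H' : Diagram t) → IsDiagram H' × ∃ λ i →
  AdjoinDomino H' i H ×
  ((Even (H' i) × LeftDomino H i (H' i)) ⊎ (Odd (H' i) × RightDomino H i (H' i)))

Deplete : ∀ {t} → Diagram t → Set
Deplete H = ¬ HasRemovableDomino H

-- Entries are stored 0-based: the entry "i" (column C_i) is stored as i-1,
-- i.e. as toℕ of the column index.  The values of b outside non-extremal
-- blocks are irrelevant.

record Tableau {t} (H : Diagram t) : Set where
  field
    b : Fin (suc t) → ℕ → ℕ
    level1 : ∀ i → 1 ≤ H i → ¬ ExtremalBlock H i 1 → b i 1 ≡ toℕ i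
    oddStep : ∀ i j → 1 ≤ j → suc j ≤ H i → ¬ ExtremalBlock H i (suc j) →
              Odd j → ∀ k → Nb H j k i → b i (suc j) ≡ b k j
    evenStep : ∀ i j → 1 ≤ j → suc j ≤ H i → ¬ ExtremalBlock H i (suc j) →
              Even j → ∀ k → Nb H j i k → b i (suc j) ≡ b k j

-- Polynomials of the form Σ_{i∈T, j∈T̂} a_{ij} c_i m^j, represented by
-- their coefficients: p i j = coefficient of c_{i+1} m^{j+1}.
-- (Every polynomial occurring here, h, f_{R_s}, f_T, is of this form.)

Poly : ℕ → Set
Poly t = Fin t → Fin (suc t) → ℤ

_⊕_ _⊖_ : ∀ {t} → Poly t → Poly t → Poly t
(p ⊕ q) i j = p i j ℤ.+ q i j
(p ⊖ q) i j = p i j ℤ.- q i j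

0P : ∀ {t} → Poly t
0P i j = + 0

-- linear form  r^a - r^b  (coefficients of m^j), for columns a, b
rpos : ℕ → ℕ → ℕ → ℤ
rpos a b j = if (j ≡ᵇ a) ∨ (j ≡ᵇ b) then + 1
             else (if (a <ᵇ j) ∧ (j <ᵇ b) then + 2 else + 0)

rdiff : ∀ {t} → Fin (suc t) → Fin (suc t) → Fin (suc t) → ℤ
rdiff a b j = if toℕ a <ᵇ toℕ b then rpos (toℕ a) (toℕ b) (toℕ j)
              else (if toℕ b <ᵇ toℕ a then - rpos (toℕ b) (toℕ a) (toℕ j) else + 0)

-- h = - Σ_{i∈T} c_i m^i
hP : ∀ {t} → Poly t
hP i j = if toℕ i ≡ᵇ toℕ j then - (+ 1) else + 0

sumFin : ∀ {n} → (Fin n → ℤ) → ℤ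
sumFin {zero}  f = + 0
sumFin {suc n} f = f Fin.zero ℤ.+ sumFin (λ k → f (Fin.suc k))

-- f_{R_s}: sum over consecutive columns u < v of height ≥ s (neighbours
-- at level s) of  c_{b(u,s)} (r^u - r^v)  (s odd)  resp.
-- c_{b(v,s)} (r^v - r^u)  (s even).
fR : ∀ {t} (H : Diagram t) → Tableau H → ℕ → Poly t
fR H 𝒯 s i j = sumFin λ u → sumFin λ v →
  if does (Nb? H s u v)
  then (if s % 2 ≡ᵇ 1
        then (if b u s ≡ᵇ toℕ i then rdiff u v j else + 0)
        else (if b v s ≡ᵇ toℕ i then rdiff v u j else + 0))
  else + 0
  where open Tableau 𝒯

sumLevels : ∀ {t} (H : Diagram t) → Tableau H → ℕ → Poly t
sumLevels H 𝒯 zero    = 0P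
sumLevels H 𝒯 (suc M) = sumLevels H 𝒯 M ⊕ fR H 𝒯 (suc M)

-- f_T = h + Σ_{s≥1} f_{R_s}  (levels above maxH are empty, f_{R_s} = 0)
fT : ∀ {t} (H : Diagram t) → Tableau H → Poly t
fT H 𝒯 = hP ⊕ sumLevels H 𝒯 (maxH H)

-- Supp f: the i ∈ T such that f depends non-trivially on c_i
Supp : ∀ {t} → Poly t → Fin t → Set
Supp p i = ∃ λ j → p i j ≢ + 0

SuppT : ∀ {t} → Diagram t → Fin t → Set
SuppT H i = 0 < H (inject₁ i)

module Submission where

-- Since f_T − h = Σ_s f_{R_s}, we study the coefficient of c_i in the
-- level polynomials f_{R_s}.  The entries of a tableau are propagated along
-- "links": at an odd level s the entry of B(p,s) is copied to its right
-- neighbour q at level s+1, at an even level to its left neighbour, and the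
-- same pair contributes the summand c_{b(p,s)}(r^p − r^q) to f_{R_s}.
-- Entries at one level are pairwise distinct, so at every level the entry i
-- occurs at most once and f_{R_s} contains c_i in at most one summand.
--
-- * If the column C_i is empty, the entry i never occurs, hence c_i does not
--   appear in f_T − h.
-- * If C_i is non-empty, the entry i starts at B(i,1) and travels upwards,
--   alternately to the right of C_i and back to C_i or to its left.  Tracking
--   the coefficient of c_i m^i level by level, it is +1 after odd levels and
--   0 or −1 after even levels; it can only end at 0 if the chain returns to
--   C_i and stops there, which the boundary conditions and depleteness rule
--   out.  Hence this coefficient of f_T − h is non-zero.

open import Defs
open import Data.Nat using (ℕ)
open import Data.Fin using (Fin)
open import Function.Bundles using (_⇔_)

open import Data.Nat as ℕ using (zero; suc; _+_; _≤_; _<_; z≤n; s≤s; _%_; _≡ᵇ_; _<ᵇ_)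
import Data.Nat.Properties as ℕP
open import Data.Fin as Fin using (toℕ; inject₁; fromℕ)
import Data.Fin.Properties as FinP
open import Data.Integer as ℤ using (ℤ; +_; -_; -[1+_])
import Data.Integer.Properties as ℤP
open import Algebra.Properties.AbelianGroup ℤP.+-0-abelianGroup using (xyx⁻¹≈y)
open import Data.Bool using (true; false; if_then_else_)
open import Data.Product using (∃; _×_; _,_; proj₁; proj₂)
open import Data.Sum using (_⊎_; inj₁; inj₂)
open import Data.Empty using (⊥; ⊥-elim)
open import Function using (_∘_)
open import Relation.Nullary using (¬_; Dec; yes; no; does)
open import Relation.Nullary.Decidable using (_×-dec_; _⊎-dec_; _→-dec_; ¬?; dec-true; dec-false)
open import Relation.Binary.PropositionalEquality
open import Relation.Binary.Definitions using (tri<; tri≈; tri>)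
open import Function.Bundles using (mk⇔)

parity : ∀ n → Even n ⊎ Odd n
parity zero          = inj₁ refl
parity (suc zero)    = inj₂ refl
parity (suc (suc n)) = parity n

even⇒odd-suc : ∀ {n} → Even n → Odd (suc n)
even⇒odd-suc {zero}          _ = refl
even⇒odd-suc {suc (suc n)}   e = even⇒odd-suc {n} e

odd⇒even-suc : ∀ {n} → Odd n → Even (suc n)
odd⇒even-suc {suc zero}      _ = refl
odd⇒even-suc {suc (suc n)}   o = odd⇒even-suc {n} o

even-odd-disjoint : ∀ n → Even n → Odd n → ⊥
even-odd-disjoint n e o with () ← trans (sym e) o

not-odd⇒even : ∀ n → ¬ Odd n → Even n
not-odd⇒even n ¬odd with parity n
... | inj₁ e = e
... | inj₂ o = ⊥-elim (¬odd o)

odd⇒positive : ∀ {n} → Odd n → 1 ≤ n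
odd⇒positive {suc n} _ = s≤s z≤n

odd-suc⇒even : ∀ {n} → Odd (suc n) → Even n
odd-suc⇒even {n} o with parity n
... | inj₁ e  = e
... | inj₂ o′ = ⊥-elim (even-odd-disjoint (suc n) (odd⇒even-suc {n} o′) o)

≡ᵇ-true : ∀ {m n} → m ≡ n → (m ≡ᵇ n) ≡ true
≡ᵇ-true = dec-true (_ ℕP.≟ _)

≡ᵇ-false : ∀ {m n} → m ≢ n → (m ≡ᵇ n) ≡ false
≡ᵇ-false = dec-false (_ ℕP.≟ _)

<ᵇ-true : ∀ {m n} → m < n → (m <ᵇ n) ≡ true
<ᵇ-true = dec-true (_ ℕP.<? _)

<ᵇ-false : ∀ {m n} → ¬ m < n → (m <ᵇ n) ≡ false
<ᵇ-false = dec-false (_ ℕP.<? _)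

rpos-end : ∀ x y → rpos x y x ≡ + 1
rpos-end x y rewrite ≡ᵇ-true {x} {x} refl = refl

rpos-inner : ∀ x y z → x < z → z < y → rpos x y z ≡ + 2
rpos-inner x y z x<z z<y
  rewrite ≡ᵇ-false (ℕP.>⇒≢ x<z) | ≡ᵇ-false (ℕP.<⇒≢ z<y) | <ᵇ-true x<z | <ᵇ-true z<y = refl

module _ {t : ℕ} {a b : Fin (suc t)} where

  rdiff-ascending : ∀ j → a Fin.< b → rdiff a b j ≡ rpos (toℕ a) (toℕ b) (toℕ j)
  rdiff-ascending j a<b rewrite <ᵇ-true a<b = refl

  rdiff-descending : ∀ j → b Fin.< a → rdiff a b j ≡ - rpos (toℕ b) (toℕ a) (toℕ j)
  rdiff-descending j b<a rewrite <ᵇ-false (ℕP.<⇒≯ b<a) | <ᵇ-true b<a = refl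

  rdiff-start : a Fin.< b → rdiff a b a ≡ + 1
  rdiff-start a<b = trans (rdiff-ascending a a<b) (rpos-end (toℕ a) (toℕ b))

  rdiff-between : ∀ {j} → a Fin.< j → j Fin.< b → rdiff a b j ≡ + 2
  rdiff-between {j} a<j j<b =
    trans (rdiff-ascending j (ℕP.<-trans a<j j<b)) (rpos-inner (toℕ a) (toℕ b) (toℕ j) a<j j<b)

  rdiff-end : b Fin.< a → rdiff a b b ≡ - + 1
  rdiff-end b<a = trans (rdiff-descending b b<a) (cong -_ (rpos-end (toℕ b) (toℕ a)))

  rdiff-between′ : ∀ {j} → b Fin.< j → j Fin.< a → rdiff a b j ≡ - + 2
  rdiff-between′ {j} b<j j<a =
    trans (rdiff-descending j (ℕP.<-trans b<j j<a)) (cong -_ (rpos-inner (toℕ b) (toℕ a) (toℕ j) b<j j<a))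

sumFin-zero : ∀ {n} (f : Fin n → ℤ) → (∀ k → f k ≡ + 0) → sumFin f ≡ + 0
sumFin-zero {zero}  f zeros = refl
sumFin-zero {suc n} f zeros = cong₂ ℤ._+_ (zeros Fin.zero) (sumFin-zero _ (zeros ∘ Fin.suc))

sumFin-single : ∀ {n} (f : Fin n → ℤ) k₀ → (∀ k → k ≢ k₀ → f k ≡ + 0) → sumFin f ≡ f k₀
sumFin-single {suc n} f Fin.zero others =
  trans (cong (λ x → f Fin.zero ℤ.+ x) (sumFin-zero _ λ k → others (Fin.suc k) λ ())) (ℤP.+-identityʳ _)
sumFin-single {suc n} f (Fin.suc k₀) others =
  trans (cong (λ x → x ℤ.+ sumFin (f ∘ Fin.suc)) (others Fin.zero λ ()))
        (trans (ℤP.+-identityˡ _)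
               (sumFin-single _ k₀ λ k k≢k₀ → others (Fin.suc k) (k≢k₀ ∘ FinP.suc-injective)))

sumFin₂-single : ∀ {m n} (f : Fin m → Fin n → ℤ) w →
                 (∀ u v → (u , v) ≢ w → f u v ≡ + 0) →
                 sumFin (λ u → sumFin (f u)) ≡ f (proj₁ w) (proj₂ w)
sumFin₂-single f (u₀ , v₀) others =
  trans (sumFin-single _ u₀ λ u u≢u₀ → sumFin-zero _ λ v → others u v (u≢u₀ ∘ cong proj₁))
        (sumFin-single _ v₀ λ v v≢v₀ → others u₀ v (v≢v₀ ∘ cong proj₂))

maxH-ub : ∀ {n} (f : Fin n → ℕ) k → f k ≤ maxH f
maxH-ub f Fin.zero    = ℕP.m≤m⊔n _ _
maxH-ub f (Fin.suc k) = ℕP.≤-trans (maxH-ub (f ∘ Fin.suc) k) (ℕP.m≤n⊔m _ _)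

maxH-mono : ∀ {n} (f g : Fin n → ℕ) → (∀ k → f k ≤ g k) → maxH f ≤ maxH g
maxH-mono {zero}  f g f≤g = z≤n
maxH-mono {suc n} f g f≤g = ℕP.⊔-mono-≤ (f≤g Fin.zero) (maxH-mono _ _ (f≤g ∘ Fin.suc))

-- A block B(u,s) that exists and is not extremal, i.e. carries an entry.

Inner : ∀ {t} → Diagram t → Fin (suc t) → ℕ → Set
Inner H u s = s ≤ H u × ¬ ExtremalBlock H u s

-- the fuel bound of the searches below survives moving the start point right
shift-bound : ∀ {x n a k} → x ≤ suc n + a → a < k → x ≤ n + k
shift-bound {n = n} {a} {k} bound a<k =
  ℕP.≤-trans bound (subst (_≤ n + k) (ℕP.+-suc n a) (ℕP.+-monoʳ-≤ n a<k))

module Diagrams {t : ℕ} (H : Diagram t) where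

  -- Existence of neighbours: a column a of height ≥ s has a right neighbour
  -- at level s as soon as some column to its right reaches level s; the
  -- search shrinks the interval (a, c) until no column inside reaches s.
  right-neighbour : ∀ s a c → a Fin.< c → s ≤ H a → s ≤ H c → ∃ λ b → Nb H s a b
  right-neighbour s a c = search (toℕ c) c (ℕP.m≤m+n _ _)
    where
    search : ∀ n c → toℕ c ≤ n + toℕ a → a Fin.< c → s ≤ H a → s ≤ H c → ∃ λ b → Nb H s a b
    search zero    c c≤a a<c _ _ = ⊥-elim (ℕP.<⇒≱ a<c c≤a)
    search (suc n) c bound a<c sa sc
      with FinP.any? (λ k → (a FinP.<? k) ×-dec (k FinP.<? c) ×-dec (s ℕP.≤? H k))
    ... | no none = c , a<c , sa , sc , λ k a<k k<c → ℕP.≰⇒> λ sk → none (k , a<k , k<c , sk)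
    ... | yes (k , a<k , k<c , sk) = search n k (ℕP.≤-pred (ℕP.≤-trans k<c bound)) a<k sa sk

  left-neighbour : ∀ s a c → a Fin.< c → s ≤ H a → s ≤ H c → ∃ λ b → Nb H s b c
  left-neighbour s a c = search (toℕ c) a (ℕP.m≤m+n _ _)
    where
    search : ∀ n a → toℕ c ≤ n + toℕ a → a Fin.< c → s ≤ H a → s ≤ H c → ∃ λ b → Nb H s b c
    search zero    a c≤a a<c _ _ = ⊥-elim (ℕP.<⇒≱ a<c c≤a)
    search (suc n) a bound a<c sa sc
      with FinP.any? (λ k → (a FinP.<? k) ×-dec (k FinP.<? c) ×-dec (s ℕP.≤? H k))
    ... | no none = a , a<c , sa , sc , λ k a<k k<c → ℕP.≰⇒> λ sk → none (k , a<k , k<c , sk)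
    ... | yes (k , a<k , k<c , sk) =
      search n k (shift-bound bound a<k)
             k<c sk sc

  rightmost : ∀ s a → s ≤ H a →
              ∃ λ z → toℕ a ≤ toℕ z × s ≤ H z × (∀ k → z Fin.< k → H k < s)
  rightmost s a = search t a (ℕP.m≤m+n _ _)
    where
    search : ∀ n a → t ≤ n + toℕ a → s ≤ H a →
             ∃ λ z → toℕ a ≤ toℕ z × s ≤ H z × (∀ k → z Fin.< k → H k < s)
    search n a bound sa with FinP.any? (λ k → (a FinP.<? k) ×-dec (s ℕP.≤? H k))
    ... | no none = a , ℕP.≤-refl , sa , λ k a<k → ℕP.≰⇒> λ sk → none (k , a<k , sk)
    search zero a bound sa | yes (k , a<k , _) =
      ⊥-elim (ℕP.<⇒≱ (ℕP.<-≤-trans a<k (FinP.toℕ≤pred[n] k)) bound)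
    search (suc n) a bound sa | yes (k , a<k , sk)
      with search n k (shift-bound bound a<k) sk
    ... | z , k≤z , sz , beyond = z , ℕP.≤-trans (ℕP.<⇒≤ a<k) k≤z , sz , beyond

  right-neighbour-unique : ∀ {s a b b′} → Nb H s a b → Nb H s a b′ → b ≡ b′
  right-neighbour-unique (a<b , _ , sb , gap) (a<b′ , _ , sb′ , gap′) with ℕP.<-cmp (toℕ _) (toℕ _)
  ... | tri< b<b′ _ _ = ⊥-elim (ℕP.<⇒≱ (gap′ _ a<b b<b′) sb)
  ... | tri≈ _ b≡b′ _ = FinP.toℕ-injective b≡b′
  ... | tri> _ _ b′<b = ⊥-elim (ℕP.<⇒≱ (gap _ a<b′ b′<b) sb′)

  left-neighbour-unique : ∀ {s a a′ b} → Nb H s a b → Nb H s a′ b → a ≡ a′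
  left-neighbour-unique (a<b , sa , _ , gap) (a′<b , sa′ , _ , gap′) with ℕP.<-cmp (toℕ _) (toℕ _)
  ... | tri< a<a′ _ _ = ⊥-elim (ℕP.<⇒≱ (gap _ a<a′ a′<b) sa′)
  ... | tri≈ _ a≡a′ _ = FinP.toℕ-injective a≡a′
  ... | tri> _ _ a′<a = ⊥-elim (ℕP.<⇒≱ (gap′ _ a′<a a<b) sa)

  odd-inner⇒right : ∀ {s u} → Odd s → ¬ ExtremalBlock H u s → ∃ λ k → u Fin.< k × s ≤ H k
  odd-inner⇒right {s} {u} o inner with FinP.any? (λ k → (u FinP.<? k) ×-dec (s ℕP.≤? H k))
  ... | yes found = found
  ... | no none = ⊥-elim (inner (inj₁ (o , λ k u<k → ℕP.≰⇒> λ sk → none (k , u<k , sk))))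

  even-inner⇒left : ∀ {s u} → Even s → ¬ ExtremalBlock H u s → ∃ λ k → k Fin.< u × s ≤ H k
  even-inner⇒left {s} {u} e inner with FinP.any? (λ k → (k FinP.<? u) ×-dec (s ℕP.≤? H k))
  ... | yes found = found
  ... | no none = ⊥-elim (inner (inj₂ (e , λ k k<u → ℕP.≰⇒> λ sk → none (k , k<u , sk))))

  right⇒odd-inner : ∀ {s u} → Odd s → (∃ λ k → u Fin.< k × s ≤ H k) → ¬ ExtremalBlock H u s
  right⇒odd-inner o (k , u<k , sk) (inj₁ (_ , below)) = ℕP.<⇒≱ (below k u<k) sk
  right⇒odd-inner {s} o _              (inj₂ (e , _))     = even-odd-disjoint s e o

  left⇒even-inner : ∀ {s u} → Even s → (∃ λ k → k Fin.< u × s ≤ H k) → ¬ ExtremalBlock H u s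
  left⇒even-inner e (k , k<u , sk) (inj₂ (_ , below)) = ℕP.<⇒≱ (below k k<u) sk
  left⇒even-inner {s} e _              (inj₁ (o , _))     = even-odd-disjoint s e o

  extremal? : ∀ u s → Dec (ExtremalBlock H u s)
  extremal? u s =
      ((s % 2 ℕP.≟ 1) ×-dec FinP.all? (λ k → (u FinP.<? k) →-dec (suc (H k) ℕP.≤? s)))
    ⊎-dec ((s % 2 ℕP.≟ 0) ×-dec FinP.all? (λ k → (k FinP.<? u) →-dec (suc (H k) ℕP.≤? s)))

  inner? : ∀ u s → Dec (Inner H u s)
  inner? u s = (s ℕP.≤? H u) ×-dec ¬? (extremal? u s)

  -- Link s p q: the block B(q,s+1) inherits its entry from B(p,s), and the
  -- pair p, q contributes c_{b(p,s)}(r^p − r^q) to f_{R_s}.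
  Link : ℕ → Fin (suc t) → Fin (suc t) → Set
  Link s p q = (Odd s × Nb H s p q) ⊎ (Even s × Nb H s q p)

  -- the summand of f_{R_s} belonging to a link is indexed by its two
  -- columns in increasing order
  linkPair : ∀ {s p q} → Link s p q → Fin (suc t) × Fin (suc t)
  linkPair {p = p} {q} (inj₁ _) = p , q
  linkPair {p = p} {q} (inj₂ _) = q , p

  linkPair-irrelevant : ∀ {s p q} (l l′ : Link s p q) → linkPair l ≡ linkPair l′
  linkPair-irrelevant (inj₁ _)       (inj₁ _)       = refl
  linkPair-irrelevant (inj₂ _)       (inj₂ _)       = refl
  linkPair-irrelevant {s} (inj₁ (o , _)) (inj₂ (e , _)) = ⊥-elim (even-odd-disjoint s e o)
  linkPair-irrelevant {s} (inj₂ (e , _)) (inj₁ (o , _)) = ⊥-elim (even-odd-disjoint s e o)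

  link-odd : ∀ {s p q} → Odd s → Link s p q → Nb H s p q
  link-odd o (inj₁ (_ , nb)) = nb
  link-odd {s} o (inj₂ (e , _))  = ⊥-elim (even-odd-disjoint s e o)

  link-even : ∀ {s p q} → Even s → Link s p q → Nb H s q p
  link-even e (inj₂ (_ , nb)) = nb
  link-even {s} e (inj₁ (o , _))  = ⊥-elim (even-odd-disjoint s e o)

  link-source : ∀ {s p q} → Link s p q → Inner H p s
  link-source (inj₁ (o , p<q , sp , sq , _)) = sp , right⇒odd-inner o (_ , p<q , sq)
  link-source (inj₂ (e , q<p , sq , sp , _)) = sp , left⇒even-inner e (_ , q<p , sq)

  link-functional : ∀ {s p q q′} → Link s p q → Link s p q′ → q ≡ q′
  link-functional (inj₁ (_ , nb)) (inj₁ (_ , nb′)) = right-neighbour-unique nb nb′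
  link-functional (inj₂ (_ , nb)) (inj₂ (_ , nb′)) = left-neighbour-unique nb nb′
  link-functional {s} (inj₁ (o , _))  (inj₂ (e , _))   = ⊥-elim (even-odd-disjoint s e o)
  link-functional {s} (inj₂ (e , _))  (inj₁ (o , _))   = ⊥-elim (even-odd-disjoint s e o)

  link-out : ∀ {s p} → Inner H p s → ∃ λ q → Link s p q
  link-out {s} {p} (sp , inner) with parity s
  ... | inj₂ o with odd-inner⇒right o inner
  ...   | k , p<k , sk with right-neighbour s p k p<k sp sk
  ...     | q , nb = q , inj₁ (o , nb)
  link-out {s} {p} (sp , inner) | inj₁ e with even-inner⇒left e inner
  ...   | k , k<p , sk with left-neighbour s k p k<p sk sp
  ...     | q , nb = q , inj₂ (e , nb)

  link-in : ∀ {s q} → Inner H q (suc s) → ∃ λ p → Link s p q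
  link-in {s} {q} (sq , inner) with parity s
  ... | inj₂ o with even-inner⇒left (odd⇒even-suc {s} o) inner
  ...   | k , k<q , sk with left-neighbour s k q k<q (ℕP.<⇒≤ sk) (ℕP.<⇒≤ sq)
  ...     | p , nb = p , inj₁ (o , nb)
  link-in {s} {q} (sq , inner) | inj₁ e with odd-inner⇒right (even⇒odd-suc {s} e) inner
  ...   | k , q<k , sk with right-neighbour s q k q<k (ℕP.<⇒≤ sq) (ℕP.<⇒≤ sk)
  ...     | p , nb = p , inj₂ (e , nb)

module Entries {t : ℕ} {H : Diagram t} (𝒯 : Tableau H) where
  open Tableau 𝒯
  open Diagrams H

  entry-link : ∀ {s p q} → 1 ≤ s → Inner H q (suc s) → Link s p q → b q (suc s) ≡ b p s
  entry-link 1≤s (sq , inner) (inj₁ (o , nb)) = oddStep  _ _ 1≤s sq inner o _ nb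
  entry-link 1≤s (sq , inner) (inj₂ (e , nb)) = evenStep _ _ 1≤s sq inner e _ nb

  EntriesDistinct : ℕ → Set
  EntriesDistinct s = ∀ {u u′} → Inner H u s → Inner H u′ s → b u s ≡ b u′ s → u ≡ u′

  -- at level 1 the entries are the column indices
  entries-distinct₁ : EntriesDistinct 1
  entries-distinct₁ (su , inner) (su′ , inner′) same =
    FinP.toℕ-injective (trans (sym (level1 _ su inner)) (trans same (level1 _ su′ inner′)))

  -- equal entries at level s+1 come along links from equal entries at level s
  entries-distinct-step : ∀ {s} → 1 ≤ s → EntriesDistinct s → EntriesDistinct (suc s)
  entries-distinct-step 1≤s distinct in-u in-u′ same with link-in in-u | link-in in-u′
  ... | p , l | p′ , l′
    with distinct (link-source l) (link-source l′)
                  (trans (sym (entry-link 1≤s in-u l)) (trans same (entry-link 1≤s in-u′ l′)))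
  ... | refl = link-functional l l′

  entries-distinct : ∀ s → 1 ≤ s → EntriesDistinct s
  entries-distinct (suc zero)    _ = entries-distinct₁
  entries-distinct (suc (suc s)) _ = entries-distinct-step (s≤s z≤n) (entries-distinct (suc s) (s≤s z≤n))

  linkPair-unique : ∀ {s p q p′ q′} → 1 ≤ s → (l : Link s p q) (l′ : Link s p′ q′) →
                    b p s ≡ b p′ s → linkPair l ≡ linkPair l′
  linkPair-unique 1≤s l l′ same with entries-distinct _ 1≤s (link-source l) (link-source l′) same
  ... | refl with link-functional l l′
  ...   | refl = linkPair-irrelevant l l′

-- The case distinction made by each summand of f_{R_s} (see Defs.fR): are
-- the two columns neighbours, is the level odd, does the relevant block
-- carry the entry?

select : ∀ {A B C D : Set} → Dec A → Dec B → Dec C → Dec D → ℤ → ℤ → ℤ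
select a? b? c? d? x y =
  if does a? then (if does b? then (if does c? then x else + 0) else (if does d? then y else + 0)) else + 0

select-first : ∀ {A B C D : Set} (a? : Dec A) → A → (b? : Dec B) → B → (c? : Dec C) → C →
               (d? : Dec D) → {x y : ℤ} → select a? b? c? d? x y ≡ x
select-first (yes _) _ (yes _) _ (yes _) _ _ = refl
select-first (no ¬a) a _       _ _       _ _ = ⊥-elim (¬a a)
select-first (yes _) _ (no ¬b) b _       _ _ = ⊥-elim (¬b b)
select-first (yes _) _ (yes _) _ (no ¬c) c _ = ⊥-elim (¬c c)

select-second : ∀ {A B C D : Set} (a? : Dec A) → A → (b? : Dec B) → ¬ B → (c? : Dec C) →
                (d? : Dec D) → D → {x y : ℤ} → select a? b? c? d? x y ≡ y
select-second (yes _) _ (no _)  _  _ (yes _) _ = refl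
select-second (no ¬a) a _       _  _ _       _ = ⊥-elim (¬a a)
select-second (yes _) _ (yes b) ¬b _ _       _ = ⊥-elim (¬b b)
select-second (yes _) _ (no _)  _  _ (no ¬d) d = ⊥-elim (¬d d)

-- The occurrences of one entry i and the coefficients of c_i in f_{R_s}.
-- Entries are stored 0-based, so "entry i" means b = toℕ i.

module Occurrences {t : ℕ} {H : Diagram t} (𝒯 : Tableau H) (i : Fin t) where
  open Tableau 𝒯
  open Diagrams H
  open Entries 𝒯

  Present : ℕ → Fin (suc t) → Set
  Present s p = Inner H p s × b p s ≡ toℕ i

  Absent : ℕ → Set
  Absent s = ∀ u → Inner H u s → b u s ≢ toℕ i

  present-unique : ∀ {s p u} → 1 ≤ s → Present s p → Inner H u s → b u s ≡ toℕ i → u ≡ p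
  present-unique 1≤s (in-p , bp) in-u bu = entries-distinct _ 1≤s in-u in-p (trans bu (sym bp))

  present-step : ∀ {s p q} → 1 ≤ s → Present s p → Link s p q → Inner H q (suc s) → Present (suc s) q
  present-step 1≤s (_ , bp) l in-q = in-q , trans (entry-link 1≤s in-q l) bp

  absent-after-stop : ∀ {s p q} → 1 ≤ s → Present s p → Link s p q → ¬ Inner H q (suc s) →
                      Absent (suc s)
  absent-after-stop 1≤s present l no-q u in-u bu with link-in in-u
  ... | p′ , l′ with present-unique 1≤s present (link-source l′) (trans (sym (entry-link 1≤s in-u l′)) bu)
  ...   | refl with link-functional l l′
  ...     | refl = no-q in-u

  absent-step : ∀ {s} → 1 ≤ s → Absent s → Absent (suc s)
  absent-step 1≤s absent u in-u bu with link-in in-u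
  ... | p , l = absent p (link-source l) (trans (sym (entry-link 1≤s in-u l)) bu)

  -- the summand of f_{R_s} at the pair of columns u < v: its coefficient of
  -- c_i m^j; by definition fR H 𝒯 s i j is the double sum of these
  summand : ℕ → Fin (suc t) → Fin (suc t) → Fin (suc t) → ℤ
  summand s u v j =
    select (Nb? H s u v) (s % 2 ℕP.≟ 1) (b u s ℕP.≟ toℕ i) (b v s ℕP.≟ toℕ i)
           (rdiff u v j) (rdiff v u j)

  summand-vanishes : ∀ s u v j →
    (∀ {p q} (l : Link s p q) → b p s ≡ toℕ i → linkPair l ≢ (u , v)) → summand s u v j ≡ + 0
  summand-vanishes s u v j off =
    vanish (Nb? H s u v) (s % 2 ℕP.≟ 1) (b u s ℕP.≟ toℕ i) (b v s ℕP.≟ toℕ i)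
    where
    vanish : (nb? : Dec (Nb H s u v)) (odd? : Dec (Odd s))
             (hit-u? : Dec (b u s ≡ toℕ i)) (hit-v? : Dec (b v s ≡ toℕ i)) →
             select nb? odd? hit-u? hit-v? (rdiff u v j) (rdiff v u j) ≡ + 0
    vanish (no _)   _         _          _          = refl
    vanish (yes _)  (yes _)   (no _)     _          = refl
    vanish (yes nb) (yes o)   (yes hit)  _          = ⊥-elim (off (inj₁ (o , nb)) hit refl)
    vanish (yes _)  (no _)    _          (no _)     = refl
    vanish (yes nb) (no ¬odd) _          (yes hit)  =
      ⊥-elim (off (inj₂ (not-odd⇒even s ¬odd , nb)) hit refl)

  summand-at-link : ∀ {s p q} j (l : Link s p q) → b p s ≡ toℕ i →
                    summand s (proj₁ (linkPair l)) (proj₂ (linkPair l)) j ≡ rdiff p q j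
  summand-at-link {s} {p} {q} j (inj₁ (o , nb)) hit =
    select-first (Nb? H s p q) nb (s % 2 ℕP.≟ 1) o (b p s ℕP.≟ toℕ i) hit (b q s ℕP.≟ toℕ i)
  summand-at-link {s} {p} {q} j (inj₂ (e , nb)) hit =
    select-second (Nb? H s q p) nb (s % 2 ℕP.≟ 1) (even-odd-disjoint s e)
                  (b q s ℕP.≟ toℕ i) (b p s ℕP.≟ toℕ i) hit

  fR-absent : ∀ {s} → Absent s → ∀ j → fR H 𝒯 s i j ≡ + 0
  fR-absent {s} absent j =
    sumFin-zero _ λ u → sumFin-zero _ λ v →
      summand-vanishes s u v j λ l hit _ → absent _ (link-source l) hit

  fR-present : ∀ {s p q} → 1 ≤ s → Present s p → (l : Link s p q) → ∀ j → fR H 𝒯 s i j ≡ rdiff p q j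
  fR-present {s} 1≤s (_ , hit) l j =
    trans (sumFin₂-single (λ u v → summand s u v j) (linkPair l) off-link) (summand-at-link j l hit)
    where
    off-link : ∀ u v → (u , v) ≢ linkPair l → summand s u v j ≡ + 0
    off-link u v other = summand-vanishes s u v j λ l′ hit′ at →
      other (trans (sym at) (linkPair-unique 1≤s l′ l (trans hit′ (sym hit))))

  absent-if-empty : ¬ 1 ≤ H (inject₁ i) → ∀ s → Absent (suc s)
  absent-if-empty empty zero u (Hu , inner) bu = empty (subst (λ x → 1 ≤ H x) u≡c Hu)
    where
    u≡c : u ≡ inject₁ i
    u≡c = FinP.toℕ-injective (trans (sym (level1 u Hu inner)) (trans bu (sym (FinP.toℕ-inject₁ i))))
  absent-if-empty empty (suc s) = absent-step (s≤s z≤n) (absent-if-empty empty s)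

  levels-vanish : ¬ 1 ≤ H (inject₁ i) → ∀ n j → sumLevels H 𝒯 n i j ≡ + 0
  levels-vanish empty zero    j = refl
  levels-vanish empty (suc n) j =
    cong₂ ℤ._+_ (levels-vanish empty n j) (fR-absent (absent-if-empty empty n) j)

module Lowering {t : ℕ} (H : Diagram t) (c : Fin (suc t)) (h : ℕ) (h≤Hc : h ≤ H c) where

  H′ : Diagram t
  H′ k = if does (k FinP.≟ c) then h else H k

  lowered-at : H′ c ≡ h
  lowered-at = cong (if_then h else H c) (dec-true (c FinP.≟ c) refl)

  lowered-elsewhere : ∀ {k} → k ≢ c → H′ k ≡ H k
  lowered-elsewhere {k} k≢c = cong (if_then h else H k) (dec-false (k FinP.≟ c) k≢c)

  lowered-≤ : ∀ k → H′ k ≤ H k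
  lowered-≤ k with k FinP.≟ c
  ... | yes refl = h≤Hc
  ... | no _     = ℕP.≤-refl

  nb-lowered : ∀ {s a b} → Nb H s a b → s ≤ H′ a → s ≤ H′ b → Nb H′ s a b
  nb-lowered (a<b , _ , _ , gap) sa sb =
    a<b , sa , sb , λ k a<k k<b → ℕP.≤-<-trans (lowered-≤ k) (gap k a<k k<b)

  max-lowered : ∀ {k} → k ≢ c → H k ≡ maxH H → H′ k ≡ maxH H′
  max-lowered {k} k≢c max = ℕP.≤-antisym (maxH-ub H′ k)
    (subst (maxH H′ ≤_) (trans (sym max) (sym (lowered-elsewhere k≢c))) (maxH-mono H′ H lowered-≤))

-- Removing a left even domino: if the column c has height n₀+2 with n₀ even,
-- and q is its right neighbour at the levels n₀+1 and n₀+2, then lowering c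
-- to n₀ preserves the boundary conditions, so H has a removable domino.

module LeftEvenDomino {t : ℕ} {H : Diagram t} (bc : IsDiagram H)
                      (c q : Fin (suc t)) (n₀ : ℕ) (even-n₀ : Even n₀) (Hc : H c ≡ suc (suc n₀))
                      (nb₁ : Nb H (suc n₀) c q) (nb₂ : Nb H (suc (suc n₀)) c q) where
  open Lowering H c n₀ (subst (n₀ ≤_) (sym Hc) (ℕP.≤-trans (ℕP.n≤1+n n₀) (ℕP.n≤1+n (suc n₀))))

  c<q : c Fin.< q
  c<q = proj₁ nb₁

  q≢c : q ≢ c
  q≢c q≡c = ℕP.<⇒≢ c<q (cong toℕ (sym q≡c))

  high-q : suc (suc n₀) ≤ H q
  high-q = proj₁ (proj₂ (proj₂ nb₂))

  raise : ∀ {k x} → k ≢ c → x ≤ H k → x ≤ H′ k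
  raise k≢c = subst (_ ≤_) (sym (lowered-elsewhere k≢c))

  just-above : ∀ {x} → x ≤ suc (suc n₀) → ¬ x ≤ n₀ → x ≡ suc n₀ ⊎ x ≡ suc (suc n₀)
  just-above x≤ x≰ with ℕP.m≤n⇒m<n∨m≡n x≤
  ... | inj₁ x<  = inj₁ (ℕP.≤-antisym (ℕP.≤-pred x<) (ℕP.≰⇒> x≰))
  ... | inj₂ x≡  = inj₂ x≡

  transfer : ∀ {k a b} → k ≢ c → Nb H (H k) a b → H k ≤ H′ a → H k ≤ H′ b → Nb H′ (H′ k) a b
  transfer k≢c nb ha hb = subst (λ x → Nb H′ x _ _) (sym (lowered-elsewhere k≢c)) (nb-lowered nb ha hb)

  -- an odd column k ≠ c that is left extremal in H′ was left extremal in H: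
  -- its left neighbour could only be c at the level n₀+1, but there the
  -- right neighbour of c is q, which is higher
  left-extremal-preserved : ∀ k → Odd (H k) → k ≢ c → LeftExtremal H′ k → LeftExtremal H k
  left-extremal-preserved k odd k≢c ext′ (a , nb@(_ , Ha , _)) with a FinP.≟ c
  ... | no a≢c = ext′ (a , transfer k≢c nb (raise a≢c Ha) (raise k≢c ℕP.≤-refl))
  ... | yes refl with H k ℕP.≤? n₀
  ...   | yes low = ext′ (c , transfer k≢c nb (subst (H k ≤_) (sym lowered-at) low) (raise k≢c ℕP.≤-refl))
  ...   | no high with just-above (subst (H k ≤_) Hc Ha) high
  ...     | inj₂ Hk≡ = even-odd-disjoint (H k) (subst Even (sym Hk≡) even-n₀) odd
  ...     | inj₁ Hk≡ with Diagrams.right-neighbour-unique H (subst (λ x → Nb H x c k) Hk≡ nb) nb₁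
  ...       | refl = ℕP.<⇒≱ (ℕP.n<1+n (suc n₀)) (subst (suc (suc n₀) ≤_) Hk≡ high-q)

  -- an even column k ≠ c that is right extremal in H′ was right extremal in H:
  -- if its right neighbour was c (necessarily at level n₀+2), then q is its
  -- right neighbour in H′
  right-extremal-preserved : ∀ k → Even (H k) → k ≢ c → RightExtremal H′ k → RightExtremal H k
  right-extremal-preserved k even k≢c ext′ (b , nb@(k<b , _ , Hb , gap)) with b FinP.≟ c
  ... | no b≢c = ext′ (b , transfer k≢c nb (raise k≢c ℕP.≤-refl) (raise b≢c Hb))
  ... | yes refl with H k ℕP.≤? n₀
  ...   | yes low = ext′ (c , transfer k≢c nb (raise k≢c ℕP.≤-refl) (subst (H k ≤_) (sym lowered-at) low))
  ...   | no high with just-above (subst (H k ≤_) Hc Hb) high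
  ...     | inj₁ Hk≡ = even-odd-disjoint (H k) even (subst Odd (sym Hk≡) (even⇒odd-suc {n₀} even-n₀))
  ...     | inj₂ Hk≡ = ext′ (q , subst (λ x → Nb H′ x k q) (sym (lowered-elsewhere k≢c)) nb-q)
    where
    nb-q : Nb H′ (H k) k q
    nb-q = ℕP.<-trans k<b c<q , raise k≢c ℕP.≤-refl , raise q≢c (subst (_≤ H q) (sym Hk≡) high-q) , below
      where
      below : ∀ x → k Fin.< x → x Fin.< q → H′ x < H k
      below x k<x x<q with x FinP.≟ c
      ... | yes refl = subst (n₀ <_) (sym Hk≡) (ℕP.m<n⇒m<1+n (ℕP.n<1+n n₀))
      ... | no x≢c with ℕP.<-cmp (toℕ x) (toℕ c)
      ...   | tri< x<c _ _ = gap x k<x x<c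
      ...   | tri≈ _ x≡c _ = ⊥-elim (x≢c (FinP.toℕ-injective x≡c))
      ...   | tri> _ _ c<x = ℕP.<-≤-trans (proj₂ (proj₂ (proj₂ nb₁)) x c<x x<q)
                               (subst (suc n₀ ≤_) (sym Hk≡) (ℕP.n≤1+n (suc n₀)))

  boundary-lowered : IsDiagram H′
  boundary-lowered k = conditions k (k FinP.≟ c)
    where
    conditions : ∀ k → Dec (k ≡ c) → (LeftExtremal H′ k → Even (H′ k) ⊎ H′ k ≡ maxH H′)
                                    × (RightExtremal H′ k → Odd (H′ k) ⊎ H′ k ≡ maxH H′)
    conditions k (yes refl) =
      (λ _ → inj₁ (subst Even (sym lowered-at) even-n₀)) , λ ext → ⊥-elim (ext nb-c-q)
      where
      nb-c-q : ∃ λ b → Nb H′ (H′ c) c b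
      nb-c-q = Diagrams.right-neighbour H′ (H′ c) c q c<q ℕP.≤-refl
                 (subst (_≤ H′ q) (sym lowered-at)
                   (raise q≢c (ℕP.≤-trans (ℕP.n≤1+n n₀) (ℕP.≤-trans (ℕP.n≤1+n (suc n₀)) high-q))))
    conditions k (no k≢c) = left , right
      where
      left : LeftExtremal H′ k → Even (H′ k) ⊎ H′ k ≡ maxH H′
      left ext with parity (H k)
      ... | inj₁ even = inj₁ (subst Even (sym (lowered-elsewhere k≢c)) even)
      ... | inj₂ odd with proj₁ (bc k) (left-extremal-preserved k odd k≢c ext)
      ...   | inj₁ even = inj₁ (subst Even (sym (lowered-elsewhere k≢c)) even)
      ...   | inj₂ max  = inj₂ (max-lowered k≢c max)
      right : RightExtremal H′ k → Odd (H′ k) ⊎ H′ k ≡ maxH H′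
      right ext with parity (H k)
      ... | inj₂ odd = inj₁ (subst Odd (sym (lowered-elsewhere k≢c)) odd)
      ... | inj₁ even with proj₂ (bc k) (right-extremal-preserved k even k≢c ext)
      ...   | inj₁ odd = inj₁ (subst Odd (sym (lowered-elsewhere k≢c)) odd)
      ...   | inj₂ max = inj₂ (max-lowered k≢c max)

  removable : HasRemovableDomino H
  removable = H′ , boundary-lowered , c ,
    (trans Hc (trans (ℕP.+-comm 2 n₀) (cong (_+ 2) (sym lowered-at))) ,
     λ k k≢c → sym (lowered-elsewhere k≢c)) ,
    inj₁ (subst Even (sym lowered-at) even-n₀ , q ,
          subst (λ x → Nb H (suc x) c q) (sym lowered-at) nb₁ ,
          subst (λ x → Nb H (suc (suc x)) c q) (sym lowered-at) nb₂)

module Boundary {t : ℕ} {H : Diagram t} (bc : IsDiagram H) where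
  open Diagrams H

  -- Unless the diagram is empty its last column is non-empty: an empty last
  -- column would be right extremal of even, hence maximal, height.
  last-column-nonempty : ∀ c → 1 ≤ H c → 1 ≤ H (fromℕ t)
  last-column-nonempty c 1≤Hc = nonempty (proj₂ (bc (fromℕ t)) nothing-right)
    where
    nothing-right : RightExtremal H (fromℕ t)
    nothing-right (k , last<k , _) =
      ℕP.<⇒≱ last<k (subst (toℕ k ≤_) (sym (FinP.toℕ-fromℕ t)) (FinP.toℕ≤pred[n] k))
    nonempty : Odd (H (fromℕ t)) ⊎ H (fromℕ t) ≡ maxH H → 1 ≤ H (fromℕ t)
    nonempty (inj₁ odd) = odd⇒positive odd
    nonempty (inj₂ max) = subst (1 ≤_) (sym max) (ℕP.≤-trans 1≤Hc (maxH-ub H c))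

  -- Right of a column c of height > s, the columns cannot reach level s+1
  -- while some column q reaches the even level s: the rightmost column of
  -- height ≥ s would be right extremal of even, non-maximal height.
  no-even-right-tail : ∀ {c q s} → Even s → c Fin.< q → s ≤ H q → suc s ≤ H c →
                       (∀ k → c Fin.< k → H k < suc s) → ⊥
  no-even-right-tail {c} {q} {s} even c<q sq sc below with rightmost s q sq
  ... | z , q≤z , sz , beyond = violates (proj₂ (bc z) right-extremal)
    where
    Hz : H z ≡ s
    Hz = ℕP.≤-antisym (ℕP.≤-pred (below z (ℕP.<-≤-trans c<q q≤z))) sz
    right-extremal : RightExtremal H z
    right-extremal (b , z<b , _ , Hb , _) = ℕP.<⇒≱ (beyond b z<b) (subst (_≤ H b) Hz Hb)
    violates : Odd (H z) ⊎ H z ≡ maxH H → ⊥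
    violates (inj₁ odd) = even-odd-disjoint s even (subst Odd Hz odd)
    violates (inj₂ max) = ℕP.<⇒≱ sc (subst (H c ≤_) (trans (sym max) Hz) (maxH-ub H c))

  -- In a deplete diagram, let c be the left neighbour of q at an even level
  -- n₀+2 ≥ 2, the columns between them staying below n₀+1.  Then the block
  -- B(c, n₀+3) exists (else c carries a removable left even domino) and is
  -- not extremal (else the part right of c violates the boundary conditions).
  inner-above-left-neighbour : Deplete H → ∀ {c q} n₀ → Even n₀ → Nb H (suc (suc n₀)) c q →
                               (∀ k → c Fin.< k → k Fin.< q → H k < suc n₀) →
                               Inner H c (suc (suc (suc n₀)))
  inner-above-left-neighbour deplete {c} {q} n₀ even-n₀ nb₂@(c<q , Hc , Hq , _) gap
    with suc (suc (suc n₀)) ℕP.≤? H c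
  ... | no low = ⊥-elim (deplete (LeftEvenDomino.removable bc c q n₀ even-n₀ Hc≡ nb₁ nb₂))
    where
    Hc≡ : H c ≡ suc (suc n₀)
    Hc≡ = ℕP.≤-antisym (ℕP.≤-pred (ℕP.≰⇒> low)) Hc
    nb₁ : Nb H (suc n₀) c q
    nb₁ = c<q , ℕP.≤-trans (ℕP.n≤1+n _) Hc , ℕP.≤-trans (ℕP.n≤1+n _) Hq , gap
  ... | yes high with extremal? c (suc (suc (suc n₀)))
  ...   | no inner = high , inner
  ...   | yes (inj₂ (even , _)) =
    ⊥-elim (even-odd-disjoint (suc (suc (suc n₀))) even (even⇒odd-suc {suc (suc n₀)} even-n₀))
  ...   | yes (inj₁ (_ , below)) = ⊥-elim (no-even-right-tail even-n₀ c<q Hq high below)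

-- The entry i
-- starts at B(i,1) and follows its links upwards; we track where it sits
-- relative to c = C_i and the coefficient L n of c_i m^i in f_{R_1}+…+f_{R_n}.

module Coefficient {t : ℕ} {H : Diagram t} (bc : IsDiagram H) (deplete : Deplete H)
                   (𝒯 : Tableau H) (i : Fin t) (nonempty : 1 ≤ H (inject₁ i)) where
  open Tableau 𝒯
  open Diagrams H
  open Occurrences 𝒯 i
  open Boundary bc

  c : Fin (suc t)
  c = inject₁ i

  L : ℕ → ℤ
  L n = sumLevels H 𝒯 n i c

  -- after an even level n: the entry i sits at B(q, n+1) with q ≤ c, the
  -- columns in (q, c] stay below level n+1, and L n is 0 (q = c) or −1 (q < c)
  record AtOrLeft (n : ℕ) : Set where
    constructor at-or-left
    field
      q       : Fin (suc t)
      present : Present (suc n) q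
      q≤c     : toℕ q ≤ toℕ c
      gap     : ∀ k → q Fin.< k → toℕ k ≤ toℕ c → H k < suc n
      value   : (q ≡ c × L n ≡ + 0) ⊎ (q Fin.< c × L n ≡ -[1+ 0 ])

  -- after an odd level n: the entry i sits at B(q, n+1) with c < q, the
  -- columns strictly between c and q stay below level n, and L n is +1
  record RightOf (n : ℕ) : Set where
    constructor right-of
    field
      q       : Fin (suc t)
      present : Present (suc n) q
      c<q     : c Fin.< q
      gap     : ∀ k → c Fin.< k → k Fin.< q → H k < n
      value   : L n ≡ + 1

  Gone : ℕ → Set
  Gone n = Absent (suc n) × L n ≢ + 0

  gone-step : ∀ {n} → Gone n → Gone (suc n)
  gone-step {n} (absent , nonzero) =
    absent-step (s≤s z≤n) absent ,
    nonzero ∘ trans (sym (trans (cong (λ x → L n ℤ.+ x) (fR-absent absent c)) (ℤP.+-identityʳ (L n))))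

  start : AtOrLeft 0
  start = at-or-left c (inner-c , trans (level1 c nonempty (proj₂ inner-c)) (FinP.toℕ-inject₁ i))
                     ℕP.≤-refl (λ k c<k k≤c → ⊥-elim (ℕP.<⇒≱ c<k k≤c)) (inj₁ (refl , refl))
    where
    c<last : c Fin.< fromℕ t
    c<last = subst₂ _<_ (sym (FinP.toℕ-inject₁ i)) (sym (FinP.toℕ-fromℕ t)) (FinP.toℕ<n i)
    inner-c : Inner H c 1
    inner-c = nonempty , right⇒odd-inner refl (fromℕ t , c<last , last-column-nonempty c nonempty)

  one≢zero : + 1 ≢ + 0
  one≢zero ()

  minus-one≢zero : -[1+ 0 ] ≢ + 0
  minus-one≢zero ()

  odd-level : ∀ {n} → Even n → AtOrLeft n → RightOf (suc n) ⊎ Gone (suc n)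
  odd-level {n} even (at-or-left q present q≤c gap value) with link-out (proj₁ present)
  ... | r , l = continue (inner? r (suc (suc n)))
    where
    nb : Nb H (suc n) q r
    nb = link-odd (even⇒odd-suc {n} even) l
    c<r : c Fin.< r
    c<r = ℕP.≰⇒> λ r≤c → ℕP.<⇒≱ (gap r (proj₁ nb) r≤c) (proj₁ (proj₂ (proj₂ nb)))
    fR-value : fR H 𝒯 (suc n) i c ≡ rdiff q r c
    fR-value = fR-present (s≤s z≤n) present l c
    value-after : (q ≡ c × L n ≡ + 0) ⊎ (q Fin.< c × L n ≡ -[1+ 0 ]) → L (suc n) ≡ + 1
    value-after (inj₁ (q≡c , L≡0)) =
      cong₂ ℤ._+_ L≡0 (trans fR-value (subst (λ x → rdiff x r c ≡ + 1) (sym q≡c) (rdiff-start c<r)))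
    value-after (inj₂ (q<c , L≡-1)) = cong₂ ℤ._+_ L≡-1 (trans fR-value (rdiff-between q<c c<r))
    new-value : L (suc n) ≡ + 1
    new-value = value-after value
    continue : Dec (Inner H r (suc (suc n))) → RightOf (suc n) ⊎ Gone (suc n)
    continue (yes inner-r) = inj₁ (right-of r (present-step (s≤s z≤n) present l inner-r) c<r
      (λ k c<k k<r → proj₂ (proj₂ (proj₂ nb)) k (ℕP.≤-<-trans q≤c c<k) k<r) new-value)
    continue (no stop) =
      inj₂ (absent-after-stop (s≤s z≤n) present l stop , one≢zero ∘ trans (sym new-value))

  -- at an even level the entry moves to the left neighbour r ≤ c, and L
  -- becomes 0 (r = c) or −1 (r < c); in the first case the entry cannot stop
  even-level : ∀ {n} → Odd n → RightOf n → AtOrLeft (suc n) ⊎ Gone (suc n)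
  even-level {suc n₀} odd (right-of q present c<q gap value) with link-out (proj₁ present)
  ... | r , l = continue (ℕP.m≤n⇒m<n∨m≡n r≤c)
    where
    nb : Nb H (suc (suc n₀)) r q
    nb = link-even (odd⇒even-suc {suc n₀} odd) l
    r≤c : toℕ r ≤ toℕ c
    r≤c = ℕP.≮⇒≥ λ c<r → ℕP.<⇒≱ (gap r c<r (proj₁ nb)) (ℕP.≤-trans (ℕP.n≤1+n _) (proj₁ (proj₂ nb)))
    new-value : L (suc (suc n₀)) ≡ + 1 ℤ.+ rdiff q r c
    new-value = cong₂ ℤ._+_ value (fR-present (s≤s z≤n) present l c)
    gap′ : ∀ k → r Fin.< k → toℕ k ≤ toℕ c → H k < suc (suc (suc n₀))
    gap′ k r<k k≤c = ℕP.m<n⇒m<1+n (proj₂ (proj₂ (proj₂ nb)) k r<k (ℕP.≤-<-trans k≤c c<q))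
    continue : toℕ r < toℕ c ⊎ toℕ r ≡ toℕ c → AtOrLeft (suc (suc n₀)) ⊎ Gone (suc (suc n₀))
    continue (inj₂ r≡c) with FinP.toℕ-injective r≡c
    ... | refl = inj₁ (at-or-left r (present-step (s≤s z≤n) present l inner-c) r≤c gap′
                         (inj₁ (refl , trans new-value (cong (λ x → + 1 ℤ.+ x) (rdiff-end c<q)))))
      where
      inner-c : Inner H c (suc (suc (suc n₀)))
      inner-c = inner-above-left-neighbour deplete n₀ (odd-suc⇒even {n₀} odd) nb gap
    continue (inj₁ r<c) = next (inner? r (suc (suc (suc n₀))))
      where
      left-value : L (suc (suc n₀)) ≡ -[1+ 0 ]
      left-value = trans new-value (cong (λ x → + 1 ℤ.+ x) (rdiff-between′ r<c c<q))
      next : Dec (Inner H r (suc (suc (suc n₀)))) → AtOrLeft (suc (suc n₀)) ⊎ Gone (suc (suc n₀))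
      next (yes inner-r) =
        inj₁ (at-or-left r (present-step (s≤s z≤n) present l inner-r) r≤c gap′ (inj₂ (r<c , left-value)))
      next (no stop) =
        inj₂ (absent-after-stop (s≤s z≤n) present l stop , minus-one≢zero ∘ trans (sym left-value))

  State : ℕ → Set
  State n = (Even n × (AtOrLeft n ⊎ Gone n)) ⊎ (Odd n × (RightOf n ⊎ Gone n))

  state : ∀ n → State n
  state zero = inj₁ (refl , inj₁ start)
  state (suc n) with state n
  ... | inj₁ (even , inj₁ here) = inj₂ (even⇒odd-suc {n} even , odd-level even here)
  ... | inj₁ (even , inj₂ gone) = inj₂ (even⇒odd-suc {n} even , inj₂ (gone-step gone))
  ... | inj₂ (odd  , inj₁ here) = inj₁ (odd⇒even-suc {n} odd , even-level odd here)
  ... | inj₂ (odd  , inj₂ gone) = inj₁ (odd⇒even-suc {n} odd , inj₂ (gone-step gone))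

  too-high : ∀ {q} → ¬ Present (suc (maxH H)) q
  too-high {q} ((high , _) , _) = ℕP.<⇒≱ high (maxH-ub H q)

  nonzero : L (maxH H) ≢ + 0
  nonzero with state (maxH H)
  ... | inj₁ (_ , inj₁ here) = ⊥-elim (too-high (AtOrLeft.present here))
  ... | inj₁ (_ , inj₂ gone) = proj₂ gone
  ... | inj₂ (_ , inj₁ here) = ⊥-elim (too-high (RightOf.present here))
  ... | inj₂ (_ , inj₂ gone) = proj₂ gone

lemma4p6 : (t : ℕ) (H : Diagram t) → IsDiagram H → Deplete H →
           (𝒯 : Tableau H) →
           ∀ (i : Fin t) → Supp (fT H 𝒯 ⊖ hP) i ⇔ SuppT H i
lemma4p6 t H bc deplete 𝒯 i = mk⇔ to from
  where
  levels : ∀ j → (fT H 𝒯 ⊖ hP) i j ≡ sumLevels H 𝒯 (maxH H) i j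
  levels j = xyx⁻¹≈y (hP i j) (sumLevels H 𝒯 (maxH H) i j)

  to : Supp (fT H 𝒯 ⊖ hP) i → SuppT H i
  to (j , nonzero) with 1 ℕP.≤? H (inject₁ i)
  ... | yes nonempty = nonempty
  ... | no empty     = ⊥-elim (nonzero (trans (levels j) (Occurrences.levels-vanish 𝒯 i empty (maxH H) j)))

  from : SuppT H i → Supp (fT H 𝒯 ⊖ hP) i
  from nonempty =
    inject₁ i , Coefficient.nonzero bc deplete 𝒯 i nonempty ∘ trans (sym (levels (inject₁ i)))
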